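{- Let $(\mathcal{Y}_x)_{x\in\mathbb{N}}$ be a sequence of finite subsets of $\mathbb{Z}$ that is additively periodic with period length $p$, with difference bounds $M^-,M^+$, and let $G$ be a Nim sequence over $(\mathcal{Y}_x)$. If $M^-\ge0$ or $M^+\le0$, then $G$ is additively periodic with period length $1$.
   Context: $\mathbb{N}=\{0,1,2,\dots\}$. For a finite $Y\subseteq\mathbb{Z}$, $\operatorname{mex}(Y)=\min(\mathbb{N}\setminus Y)$. $(\mathcal{Y}_x)$ is additively periodic with period length $p\ge1$ if $\mathcal{Y}_{x+p}=\mathcal{Y}_x+p$ for all $x\in\mathbb{N}$, $p$ least such. Difference bounds: $M^+=\max\{z-x: x\in\mathbb{N}, z\in\mathcal{Y}_x\}+1$, $M^-=\min\{z-x: x\in\mathbb{N}, z\in\mathcal{Y}_x\}-1$. A Nim sequence over $(\mathcal{Y}_x)$ with seed $[g_0,\dots,g_{L-1}]$ ($L\in\mathbb{N}$, $g_i\in\mathbb{N}$ pairwise distinct) is $G:\mathbb{N}\to\mathbb{N}$ with $G(x)=g_x$ for $x<L$ and $G(x)=\operatorname{mex}(\{G(x'):x'<x\}\cup\mathcal{Y}_x)$ for $x\ge L$. $G$ is additively periodic with period length $\tilde p$ if $\tilde p\ge1$ is least such that for some $\tilde P$, $G(x+\tilde p)=G(x)+\tilde p$ for all $x\ge\tilde P$. -}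

module Defs where

open import Data.Nat as ℕ using (ℕ; zero; suc)
open import Data.Integer as ℤ using (ℤ; +_; _-_)
open import Data.List using (List; length; lookup)
open import Data.List.Membership.Propositional using (_∈_)
open import Data.List.Relation.Unary.Unique.Propositional using (Unique)
open import Data.Fin using (Fin; toℕ)
open import Data.Product using (Σ; ∃; ∃-syntax; _×_)
open import Data.Sum using (_⊎_)
open import Relation.Binary.PropositionalEquality using (_≡_)
open import Relation.Nullary using (¬_)
open import Function.Bundles using (_⇔_)

SetSeq : Set
SetSeq = ℕ → List ℤ

AddPeriodicWith : SetSeq → ℕ → Set
AddPeriodicWith Y p = ∀ (x : ℕ) (z : ℤ) → (z ∈ Y (x ℕ.+ p)) ⇔ ((z - + p) ∈ Y x)

IsAddPeriodLength : SetSeq → ℕ → Set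
IsAddPeriodLength Y p =
  1 ℕ.≤ p × AddPeriodicWith Y p × (∀ q → 1 ℕ.≤ q → q ℕ.< p → ¬ AddPeriodicWith Y q)

IsUpperDiffBound : SetSeq → ℤ → Set
IsUpperDiffBound Y M =
  (∃[ x ] ∃[ z ] (z ∈ Y x × M ≡ (z - + x) ℤ.+ + 1))
  × (∀ x z → z ∈ Y x → (z - + x) ℤ.+ + 1 ℤ.≤ M)

IsLowerDiffBound : SetSeq → ℤ → Set
IsLowerDiffBound Y M =
  (∃[ x ] ∃[ z ] (z ∈ Y x × M ≡ (z - + x) - + 1))
  × (∀ x z → z ∈ Y x → M ℤ.≤ (z - + x) - + 1)

IsMex : (ℤ → Set) → ℕ → Set
IsMex S m = ¬ S (+ m) × (∀ k → k ℕ.< m → S (+ k))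

Options : SetSeq → (ℕ → ℕ) → ℕ → ℤ → Set
Options Y G x z = (∃[ x' ] (x' ℕ.< x × z ≡ + G x')) ⊎ (z ∈ Y x)

IsNimSequence : SetSeq → List ℕ → (ℕ → ℕ) → Set
IsNimSequence Y seed G =
  Unique seed
  × (∀ (i : Fin (length seed)) → G (toℕ i) ≡ lookup seed i)
  × (∀ x → length seed ℕ.≤ x → IsMex (Options Y G x) (G x))

EventuallyAddPeriodicWith : (ℕ → ℕ) → ℕ → Set
EventuallyAddPeriodicWith G q = ∃[ P ] (∀ x → P ℕ.≤ x → G (x ℕ.+ q) ≡ G x ℕ.+ q)

IsNimPeriodLength : (ℕ → ℕ) → ℕ → Set
IsNimPeriodLength G q =
  1 ℕ.≤ q × EventuallyAddPeriodicWith G q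
  × (∀ r → 1 ℕ.≤ r → r ℕ.< q → ¬ EventuallyAddPeriodicWith G r)

module Submission where

-- Let H x = max {G y + 1 : y < x}; injectivity of G gives x ≤ H x.
-- If M⁺ ≤ 0, every 𝒴_x lies in [x - c, x) for c = |M⁻|, so past the seed G x ≤ H x and the
-- excess H x - x never grows.  While it is positive, some h < H x is missed by G before x and
-- stays missed; every step at which the excess does not drop has G x = H x > h, which forces
-- h ∈ 𝒴_x and hence x ≤ h + c.  So the excess reaches 0, and from then on G x = x.
-- If M⁻ ≥ 0, every 𝒴_x lies above x, so past the seed G is the mex of its own earlier values:
-- it is strictly increasing and, once above all seed values, increases by exactly 1.

open import Defs
open import Data.Nat using (ℕ)
open import Data.Integer using (ℤ; +_; _≤_)
open import Data.List using (List)
open import Data.Sum using (_⊎_)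

open import Data.Nat as ℕ
  using (zero; suc; _+_; _∸_; _⊔_; _<_; _≮_; z≤n; s≤s; s≤s⁻¹)
open import Data.Nat.Properties
import Data.Integer as ℤ
import Data.Integer.Properties as ℤ
open import Data.Integer.Tactic.RingSolver using (solve-∀)
open import Data.List using (length; lookup)
open import Data.List.Membership.Propositional using (_∈_)
open import Data.List.Membership.Propositional.Properties using (∈-lookup)
import Data.List.Relation.Unary.All as All
open import Data.List.Relation.Unary.AllPairs using (_∷_)
open import Data.List.Relation.Unary.Unique.Propositional using (Unique)
open import Data.Fin as Fin using (Fin; toℕ; fromℕ<)
open import Data.Fin.Properties
  using (toℕ<n; toℕ-fromℕ<; fromℕ<-injective; toℕ-injective; injective⇒≤)
open import Data.Product using (∃-syntax; _×_; _,_; proj₁; proj₂)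
open import Data.Sum using (inj₁; inj₂)
open import Data.Empty using (⊥-elim)
open import Function.Base using (_∘_)
open import Function.Definitions using (Injective)
open import Relation.Nullary using (¬_; Dec; yes; no)
open import Relation.Nullary.Decidable using (¬?; decidable-stable)
open import Relation.Binary using (tri<; tri≈; tri>)
open import Relation.Binary.PropositionalEquality

-i≤+∣i∣ : ∀ i → ℤ.- i ≤ + ℤ.∣ i ∣
-i≤+∣i∣ (+ n)      = ℤ.neg-≤-pos
-i≤+∣i∣ ℤ.-[1+ n ] = ℤ.≤-refl

module _ {Y : SetSeq} where

  nonpos-upper⇒below : ∀ {M} → IsUpperDiffBound Y M → M ≤ + 0 →
                       ∀ {x k} → + k ∈ Y x → k < x
  nonpos-upper⇒below (_ , bound) M≤0 {x} {k} k∈Y =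
    ℤ.drop‿+≤+ (ℤ.i-j≤0⇒i≤j (subst (_≤ + 0) (shift (+ k) (+ x))
                                    (ℤ.≤-trans (bound x (+ k) k∈Y) M≤0)))
    where
    shift : ∀ i j → (i ℤ.- j) ℤ.+ ℤ.1ℤ ≡ (ℤ.1ℤ ℤ.+ i) ℤ.- j
    shift = solve-∀

  nonneg-lower⇒above : ∀ {M} → IsLowerDiffBound Y M → + 0 ≤ M →
                       ∀ {x k} → + k ∈ Y x → x < k
  nonneg-lower⇒above (_ , bound) 0≤M {x} {k} k∈Y =
    ℤ.drop‿+≤+ (ℤ.0≤i-j⇒j≤i (subst (+ 0 ≤_) (shift (+ k) (+ x))
                                    (ℤ.≤-trans 0≤M (bound x (+ k) k∈Y))))
    where
    shift : ∀ i j → (i ℤ.- j) ℤ.- ℤ.1ℤ ≡ i ℤ.- (ℤ.1ℤ ℤ.+ j)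
    shift = solve-∀

  lower⇒near : ∀ {M} → IsLowerDiffBound Y M →
               ∀ {x k} → + k ∈ Y x → x ℕ.≤ k + ℤ.∣ M ∣
  lower⇒near {M} (_ , bound) {x} {k} k∈Y =
    <⇒≤ (ℤ.drop‿+≤+ (ℤ.≤-trans 1+x≤k-M k-M≤k+∣M∣))
    where
    shift : ∀ i j m → ((i ℤ.- j) ℤ.- ℤ.1ℤ) ℤ.- m ≡ (i ℤ.- m) ℤ.- (ℤ.1ℤ ℤ.+ j)
    shift = solve-∀
    1+x≤k-M : + suc x ≤ + k ℤ.- M
    1+x≤k-M = ℤ.0≤i-j⇒j≤i (subst (+ 0 ≤_) (shift (+ k) (+ x) M)
                                 (ℤ.i≤j⇒0≤j-i (bound x (+ k) k∈Y)))
    k-M≤k+∣M∣ : + k ℤ.- M ≤ + (k + ℤ.∣ M ∣)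
    k-M≤k+∣M∣ = ℤ.+-monoʳ-≤ (+ k) (-i≤+∣i∣ M)

AttainedBefore : (ℕ → ℕ) → ℕ → ℕ → Set
AttainedBefore f x k = ∃[ y ] (y < x × f y ≡ k)

height : (ℕ → ℕ) → ℕ → ℕ
height f zero    = 0
height f (suc x) = height f x ⊔ suc (f x)

module _ (f : ℕ → ℕ) where

  <height : ∀ {x y} → y < x → f y < height f x
  <height {suc x} y<1+x with m≤n⇒m<n∨m≡n (s≤s⁻¹ y<1+x)
  ... | inj₁ y<x  = ≤-trans (<height y<x) (m≤m⊔n (height f x) (suc (f x)))
  ... | inj₂ refl = m≤n⊔m (height f x) (suc (f x))

  covered⇒≤ : ∀ {n x} → (∀ {k} → k < n → AttainedBefore f x k) → n ℕ.≤ x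
  covered⇒≤ {n} {x} covered = injective⇒≤ {f = preimage} preimage-injective
    where
    preimage : Fin n → Fin x
    preimage k with covered (toℕ<n k)
    ... | y , y<x , _ = fromℕ< y<x
    preimage-injective : Injective _≡_ _≡_ preimage
    preimage-injective {i} {j} eq with covered (toℕ<n i) | covered (toℕ<n j)
    ... | y , y<x , fy≡i | y′ , y′<x , fy′≡j = toℕ-injective (begin
      toℕ i ≡⟨ fy≡i ⟨
      f y   ≡⟨ cong f (fromℕ<-injective y y′ y<x y′<x eq) ⟩
      f y′  ≡⟨ fy′≡j ⟩
      toℕ j ∎)
      where open ≡-Reasoning

  injective⇒≤height : Injective _≡_ _≡_ f → ∀ x → x ℕ.≤ height f x
  injective⇒≤height f-injective x = injective⇒≤ {f = value} value-injective
    where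
    value : Fin x → Fin (height f x)
    value k = fromℕ< (<height (toℕ<n k))
    value-injective : Injective _≡_ _≡_ value
    value-injective {i} {j} eq = toℕ-injective (f-injective
      (fromℕ<-injective _ _ (<height (toℕ<n i)) (<height (toℕ<n j)) eq))

  attainedBefore? : ∀ x k → Dec (AttainedBefore f x k)
  attainedBefore? x k = anyUpTo? (λ y → f y ℕ.≟ k) x

  hole-below-height : ∀ {x} → x < height f x →
                      ∃[ h ] (h < height f x × ¬ AttainedBefore f x h)
  hole-below-height {x} x<height with anyUpTo? (¬? ∘ attainedBefore? x) (height f x)
  ... | yes hole   = hole
  ... | no no-hole = ⊥-elim (<⇒≱ x<height (covered⇒≤ λ {k} k<height →
          decidable-stable (attainedBefore? x k) λ missed → no-hole (k , k<height , missed)))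

lookup-distinct : ∀ {xs : List ℕ} → Unique xs → ∀ {i j} → i Fin.< j → lookup xs i ≢ lookup xs j
lookup-distinct (x∉xs ∷ _) {Fin.zero}  {Fin.suc j} _   = All.lookup x∉xs (∈-lookup j)
lookup-distinct (_ ∷ u)    {Fin.suc i} {Fin.suc j} i<j = lookup-distinct u (s≤s⁻¹ i<j)

module NimSequence {Y : SetSeq} {seed : List ℕ} {G : ℕ → ℕ}
                   (nim : IsNimSequence Y seed G) where

  L : ℕ
  L = length seed

  private
    mex : ∀ {x} → L ℕ.≤ x → IsMex (Options Y G x) (G x)
    mex {x} = proj₂ (proj₂ nim) x

  G-fresh : ∀ {x} → L ℕ.≤ x → ¬ AttainedBefore G x (G x)
  G-fresh Lx (y , y<x , Gy≡Gx) = proj₁ (mex Lx) (inj₁ (y , y<x , cong +_ (sym Gy≡Gx)))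

  G-mex : ∀ {x k} → L ℕ.≤ x → k < G x → AttainedBefore G x k ⊎ + k ∈ Y x
  G-mex Lx k<Gx with proj₂ (mex Lx) _ k<Gx
  ... | inj₁ (y , y<x , k≡Gy) = inj₁ (y , y<x , sym (ℤ.+-injective k≡Gy))
  ... | inj₂ k∈Y              = inj₂ k∈Y

  hole-in-Y : ∀ {x h} → L ℕ.≤ x → h < G x → ¬ AttainedBefore G x h → + h ∈ Y x
  hole-in-Y Lx h<Gx fresh with G-mex Lx h<Gx
  ... | inj₁ attained = ⊥-elim (fresh attained)
  ... | inj₂ h∈Y      = h∈Y

  G-seed : ∀ {i} (i<L : i < L) → G i ≡ lookup seed (fromℕ< i<L)
  G-seed i<L = trans (cong G (sym (toℕ-fromℕ< i<L))) (proj₁ (proj₂ nim) (fromℕ< i<L))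

  G-distinct : ∀ {i j} → i < j → G i ≢ G j
  G-distinct {i} {j} i<j Gi≡Gj with L ℕ.≤? j
  ... | yes Lj = G-fresh Lj (i , i<j , Gi≡Gj)
  ... | no j≮L = lookup-distinct (proj₁ nim)
      (subst₂ _<_ (sym (toℕ-fromℕ< i<L)) (sym (toℕ-fromℕ< j<L)) i<j)
      (trans (sym (G-seed i<L)) (trans Gi≡Gj (G-seed j<L)))
    where
    j<L = ≰⇒> j≮L
    i<L = <-trans i<j j<L

  G-injective : Injective _≡_ _≡_ G
  G-injective {i} {j} Gi≡Gj with <-cmp i j
  ... | tri< i<j _ _ = ⊥-elim (G-distinct i<j Gi≡Gj)
  ... | tri≈ _ i≡j _ = i≡j
  ... | tri> _ _ j<i = ⊥-elim (G-distinct j<i (sym Gi≡Gj))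

module _ {Y : SetSeq} {seed : List ℕ} {G : ℕ → ℕ} (nim : IsNimSequence Y seed G) where
  open NimSequence nim

  module BelowDiagonal (below : ∀ {x k} → + k ∈ Y x → k < x)
                       (c : ℕ) (near : ∀ {x k} → + k ∈ Y x → x ℕ.≤ k + c) where

    H : ℕ → ℕ
    H = height G

    G≤height : ∀ {x} → L ℕ.≤ x → G x ℕ.≤ H x
    G≤height {x} Lx with G x ℕ.≤? H x
    ... | yes Gx≤Hx = Gx≤Hx
    ... | no Gx≰Hx with G-mex Lx (≰⇒> Gx≰Hx)
    ...   | inj₁ (y , y<x , Gy≡Hx) = ⊥-elim (<-irrefl Gy≡Hx (<height G y<x))
    ...   | inj₂ Hx∈Y = ⊥-elim (<⇒≱ (below Hx∈Y) (injective⇒≤height G G-injective x))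

    complete-step : ∀ {x} → L ℕ.≤ x → H x ℕ.≤ x → G x ≡ x × H (suc x) ℕ.≤ suc x
    complete-step {x} Lx Hx≤x = Gx≡x , ⊔-lub (m≤n⇒m≤1+n Hx≤x) (s≤s (≤-reflexive Gx≡x))
      where
      Gx≡x : G x ≡ x
      Gx≡x with m≤n⇒m<n∨m≡n (≤-trans (G≤height Lx) Hx≤x)
      ... | inj₂ Gx≡x = Gx≡x
      ... | inj₁ Gx<x = ⊥-elim (1+n≰n (≤-trans (injective⇒≤height G G-injective (suc x))
                                               (⊔-lub Hx≤x Gx<x)))

    complete-forever : ∀ {X} → L ℕ.≤ X → H X ℕ.≤ X → ∀ d → H (d + X) ℕ.≤ d + X
    complete-forever LX HX≤X zero    = HX≤X
    complete-forever LX HX≤X (suc d) =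
      proj₂ (complete-step (≤-trans LX (m≤n+m _ d)) (complete-forever LX HX≤X d))

    excess-drops : ∀ n {e x h} → L ℕ.≤ x → H x ≡ suc e + x →
                   h < H x → ¬ AttainedBefore G x h → h + c < n + x →
                   ∃[ X ] (L ℕ.≤ X × H X ℕ.≤ e + X)
    excess-drops n {e} {x} {h} Lx Hx≡ h<Hx fresh far with m≤n⇒m<n∨m≡n (G≤height Lx)
    ... | inj₁ Gx<Hx = suc x , m≤n⇒m≤1+n Lx , ≤-reflexive (begin
      H x ⊔ suc (G x) ≡⟨ m≥n⇒m⊔n≡m Gx<Hx ⟩
      H x             ≡⟨ Hx≡ ⟩
      suc e + x       ≡⟨ +-suc e x ⟨
      e + suc x       ∎)
      where open ≡-Reasoning
    ... | inj₂ Gx≡Hx = keep-going n far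
      where
      h∈Y : + h ∈ Y x
      h∈Y = hole-in-Y Lx (subst (h <_) (sym Gx≡Hx) h<Hx) fresh
      H[1+x]≡ : H (suc x) ≡ suc e + suc x
      H[1+x]≡ = begin
        H x ⊔ suc (G x)   ≡⟨ cong (λ g → H x ⊔ suc g) Gx≡Hx ⟩
        H x ⊔ suc (H x)   ≡⟨ m≤n⇒m⊔n≡n (n≤1+n (H x)) ⟩
        suc (H x)         ≡⟨ cong suc Hx≡ ⟩
        suc (suc e + x)   ≡⟨ +-suc (suc e) x ⟨
        suc e + suc x     ∎
        where open ≡-Reasoning
      still-fresh : ¬ AttainedBefore G (suc x) h
      still-fresh (y , y<1+x , Gy≡h) with m≤n⇒m<n∨m≡n (s≤s⁻¹ y<1+x)
      ... | inj₁ y<x  = fresh (y , y<x , Gy≡h)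
      ... | inj₂ refl = <-irrefl (trans (sym Gy≡h) Gx≡Hx) h<Hx
      keep-going : ∀ n → h + c < n + x → ∃[ X ] (L ℕ.≤ X × H X ℕ.≤ e + X)
      keep-going zero    far = ⊥-elim (<⇒≱ far (near h∈Y))
      keep-going (suc n) far = excess-drops n (m≤n⇒m≤1+n Lx) H[1+x]≡
        (<-≤-trans h<Hx (m≤m⊔n (H x) _)) still-fresh
        (subst (h + c <_) (sym (+-suc n x)) far)

    eventually-complete : ∀ e {x} → L ℕ.≤ x → H x ℕ.≤ e + x → ∃[ X ] (L ℕ.≤ X × H X ℕ.≤ X)
    eventually-complete zero    Lx Hx≤x = _ , Lx , Hx≤x
    eventually-complete (suc e) {x} Lx Hx≤ with H x ℕ.≤? e + x
    ... | yes Hx≤′ = eventually-complete e Lx Hx≤′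
    ... | no Hx≰ =
      let Hx≡ = ≤-antisym Hx≤ (≰⇒> Hx≰)
          h , h<Hx , fresh = hole-below-height G (subst (x <_) (sym Hx≡) (s≤s (m≤n+m x e)))
          X , LX , HX≤ = excess-drops (suc (h + c)) Lx Hx≡ h<Hx fresh (m≤m+n (suc (h + c)) x)
      in eventually-complete e LX HX≤

    eventually-successor : ∃[ X ] (∀ d → G (suc (d + X)) ≡ suc (G (d + X)))
    eventually-successor with eventually-complete (H L) ≤-refl (m≤m+n (H L) L)
    ... | X , LX , HX≤X = X , λ d → trans (identity (suc d)) (cong suc (sym (identity d)))
      where
      identity : ∀ d → G (d + X) ≡ d + X
      identity d = proj₁ (complete-step (≤-trans LX (m≤n+m X d)) (complete-forever LX HX≤X d))

  module AboveDiagonal (above : ∀ {x k} → + k ∈ Y x → x < k) where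

    G≤id : ∀ {x} → L ℕ.≤ x → G x ℕ.≤ x
    G≤id {x} Lx with G x ℕ.≤? x
    ... | yes Gx≤x = Gx≤x
    ... | no Gx≰x  = ⊥-elim (1+n≰n (covered⇒≤ G covered))
      where
      covered : ∀ {k} → k < suc x → AttainedBefore G x k
      covered k<1+x with G-mex Lx (<-≤-trans k<1+x (≰⇒> Gx≰x))
      ... | inj₁ attained = attained
      ... | inj₂ k∈Y      = ⊥-elim (<⇒≱ (above k∈Y) (s≤s⁻¹ k<1+x))

    below-attained : ∀ {x k} → L ℕ.≤ x → k < G x → AttainedBefore G x k
    below-attained Lx k<Gx with G-mex Lx k<Gx
    ... | inj₁ attained = attained
    ... | inj₂ k∈Y      = ⊥-elim (<⇒≱ (<-trans (above k∈Y) k<Gx) (G≤id Lx))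

    G-increasing : ∀ {x} → L ℕ.≤ x → G x < G (suc x)
    G-increasing {x} Lx = ≤∧≢⇒< (≮⇒≥ not-below) (G-distinct (n<1+n x))
      where
      not-below : G (suc x) ≮ G x
      not-below lt with below-attained Lx lt
      ... | y , y<x , Gy≡ = G-distinct (m<n⇒m<1+n y<x) Gy≡

    G-grows : ∀ d → d ℕ.≤ G (d + L)
    G-grows zero    = z≤n
    G-grows (suc d) = <-≤-trans (s≤s (G-grows d)) (G-increasing (m≤n+m L d))

    G-step : ∀ {x} → L ℕ.≤ x → height G L ℕ.≤ suc (G x) → G (suc x) ≡ suc (G x)
    G-step {x} Lx HL≤ = ≤-antisym (≮⇒≥ no-gap) (G-increasing Lx)
      where
      no-gap : suc (G x) ≮ G (suc x)
      no-gap lt with below-attained (m≤n⇒m≤1+n Lx) lt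
      ... | y , y<1+x , Gy≡ with L ℕ.≤? y
      ...   | no y≮L = <-irrefl Gy≡ (<-≤-trans (<height G (≰⇒> y≮L)) HL≤)
      ...   | yes Ly with below-attained Ly (subst (G x <_) (sym Gy≡) (n<1+n (G x)))
      ...     | y′ , y′<y , Gy′≡Gx = G-distinct (<-≤-trans y′<y (s≤s⁻¹ y<1+x)) Gy′≡Gx

    eventually-successor : ∃[ X ] (∀ d → G (suc (d + X)) ≡ suc (G (d + X)))
    eventually-successor = height G L + L , λ d → G-step (L≤ d) (HL≤ d)
      where
      L≤ : ∀ d → L ℕ.≤ d + (height G L + L)
      L≤ d = ≤-trans (m≤n+m L (d + height G L)) (≤-reflexive (+-assoc d (height G L) L))
      HL≤ : ∀ d → height G L ℕ.≤ suc (G (d + (height G L + L)))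
      HL≤ d = begin
        height G L                  ≤⟨ m≤n+m (height G L) d ⟩
        d + height G L              ≤⟨ G-grows (d + height G L) ⟩
        G (d + height G L + L)      ≡⟨ cong G (+-assoc d (height G L) L) ⟩
        G (d + (height G L + L))    ≤⟨ n≤1+n _ ⟩
        suc (G (d + (height G L + L))) ∎
        where open ≤-Reasoning

eventually-successor⇒period-1 : ∀ {G} → ∃[ X ] (∀ d → G (suc (d + X)) ≡ suc (G (d + X))) →
                                IsNimPeriodLength G 1
eventually-successor⇒period-1 {G} (X , step) =
  ≤-refl , (X , periodic) , λ r 1≤r r<1 _ → <⇒≱ r<1 1≤r
  where
  periodic : ∀ x → X ℕ.≤ x → G (x + 1) ≡ G x + 1
  periodic x X≤x = begin
    G (x + 1)               ≡⟨ cong G (+-comm x 1) ⟩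
    G (suc x)               ≡⟨ cong (G ∘ suc) (m∸n+n≡m X≤x) ⟨
    G (suc (x ∸ X + X))     ≡⟨ step (x ∸ X) ⟩
    suc (G (x ∸ X + X))     ≡⟨ cong (suc ∘ G) (m∸n+n≡m X≤x) ⟩
    suc (G x)               ≡⟨ +-comm 1 (G x) ⟩
    G x + 1                 ∎
    where open ≡-Reasoning

mainTheorem4 : (Y : SetSeq) (p : ℕ) (Mminus Mplus : ℤ) (seed : List ℕ) (G : ℕ → ℕ)
    → IsAddPeriodLength Y p
    → IsLowerDiffBound Y Mminus
    → IsUpperDiffBound Y Mplus
    → IsNimSequence Y seed G
    → (+ 0 ≤ Mminus ⊎ Mplus ≤ + 0)
    → IsNimPeriodLength G 1
mainTheorem4 _ _ _ _ _ _ _ lower _ nim (inj₁ 0≤M⁻) =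
  eventually-successor⇒period-1
    (AboveDiagonal.eventually-successor nim (nonneg-lower⇒above lower 0≤M⁻))
mainTheorem4 _ _ M⁻ _ _ _ _ lower upper nim (inj₂ M⁺≤0) =
  eventually-successor⇒period-1
    (BelowDiagonal.eventually-successor nim (nonpos-upper⇒below upper M⁺≤0)
                                        ℤ.∣ M⁻ ∣ (lower⇒near lower))
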